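{- For every $\mathsf{xSKSg}$ proof of size $n$ there exists an $\mathsf{sSKSg}$ proof of the same formula whose length and size are respectively $O(n)$ and $O(n^2)$.
   Context: CoS: formulae built from units $\mathsf f,\mathsf t$, atoms $a,\bar a,\dots$, formula variables $A,\bar A,\dots$ by $[\alpha\vee\beta]$ and $(\alpha\wedge\beta)$; $\bar\cdot$ involution on atoms and on variables with $\bar a\ne a$, $\bar A\ne A$; the De Morgan dual $\bar\alpha$ exchanges $\vee/\wedge$, $\mathsf t/\mathsf f$ and negates atoms and variables. Equality $=$ is the smallest context-closed equivalence containing commutativity and associativity of $\vee,\wedge$, $[\alpha\vee\mathsf f]=\alpha$, $(\alpha\wedge\mathsf t)=\alpha$, $[\mathsf t\vee\mathsf t]=\mathsf t$, $(\mathsf f\wedge\mathsf f)=\mathsf f$. A substitution $\sigma$ maps variables to formulae (applied simultaneously, $\bar A\mapsto$ dual of $\sigma(A)$); a renaming maps atoms to atoms. A rule $\alpha/\beta$ has instances $\alpha\rho\sigma/\beta\rho\sigma$ and generates steps $\xi\{\gamma\}/\xi\{\delta\}$ for any context (formula with one hole) $\xi$. A derivation in $\mathcal S$ from premiss $\alpha_0$ to conclusion $\alpha_k$ is a chain alternating $=$-steps and steps generated by rules of $\mathcal S$; its length is the number of steps and its size the number of occurrences of units, atoms and variables; a proof has premiss $\mathsf t$. $\mathsf{SKSg}$ has the rules $\mathsf t/[A\vee\bar A]$, $(A\wedge\bar A)/\mathsf f$, $\mathsf f/A$, $A/\mathsf t$, $[A\vee A]/A$, $A/(A\wedge A)$,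 $(A\wedge[B\vee C])/[(A\wedge B)\vee C]$. $\mathsf{xSKSg}$: an extended $\mathsf{SKSg}$ proof of $\alpha$ is an $\mathsf{SKSg}$ derivation with conclusion $\alpha$ and premiss $([\bar A_1\vee\beta_1]\wedge[\bar\beta_1\vee A_1]\wedge\dots\wedge[\bar A_h\vee\beta_h]\wedge[\bar\beta_h\vee A_h])$, where $A_1,\bar A_1,\dots,A_h,\bar A_h$ are mutually distinct variables and, for each $i$, neither $A_i$ nor $\bar A_i$ occurs in $\beta_1,\dots,\beta_i,\alpha$. $\mathsf{sSKSg}$: a proof of $\mathsf{SKSg}$ in which, in addition to steps generated by $\mathsf{SKSg}$ rules, one may use steps of the substitution rule, i.e. steps from a whole formula $\gamma$ (the entire current line, not inside a context) to $\gamma\sigma$ for a substitution $\sigma$. -}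

module Defs where

open import Data.Nat using (ℕ; zero; suc; _+_; _*_; _≤_)
open import Data.Bool using (Bool; true; false; not)
open import Data.Product using (_×_; _,_; proj₁; proj₂; Σ; ∃)
open import Data.Sum using (_⊎_)
open import Data.Empty using (⊥)
open import Data.Fin using (Fin; toℕ)
open import Data.List using (List; []; _∷_; concatMap; tabulate)
open import Data.List.Membership.Propositional using (_∈_)
open import Relation.Binary.PropositionalEquality using (_≡_; _≢_)

-- Atoms and formula variables.
-- A name together with a polarity; the involution ‾ flips the polarity,
-- so it is an involution without fixed points (ā ≠ a, Ā ≠ A).

Atom : Set
Atom = ℕ × Bool

Var : Set
Var = ℕ × Bool

bar : ℕ × Bool → ℕ × Bool
bar (n , b) = (n , not b)

data Formula : Set where
  𝕗 𝕥 : Formula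
  atom : Atom → Formula
  var  : Var → Formula
  [_∨_] : Formula → Formula → Formula
  ⟨_∧_⟩ : Formula → Formula → Formula

dual : Formula → Formula
dual 𝕗 = 𝕥
dual 𝕥 = 𝕗
dual (atom a) = atom (bar a)
dual (var A) = var (bar A)
dual [ α ∨ β ] = ⟨ dual α ∧ dual β ⟩
dual ⟨ α ∧ β ⟩ = [ dual α ∨ dual β ]

fsize : Formula → ℕ
fsize 𝕗 = 1
fsize 𝕥 = 1
fsize (atom _) = 1
fsize (var _) = 1
fsize [ α ∨ β ] = fsize α + fsize β
fsize ⟨ α ∧ β ⟩ = fsize α + fsize β

Occurs : Var → Formula → Set
Occurs v 𝕗 = ⊥
Occurs v 𝕥 = ⊥
Occurs v (atom _) = ⊥
Occurs v (var w) = v ≡ w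
Occurs v [ α ∨ β ] = Occurs v α ⊎ Occurs v β
Occurs v ⟨ α ∧ β ⟩ = Occurs v α ⊎ Occurs v β

infix 4 _≈_
data _≈_ : Formula → Formula → Set where
  ≈-refl  : ∀ {α} → α ≈ α
  ≈-sym   : ∀ {α β} → α ≈ β → β ≈ α
  ≈-trans : ∀ {α β γ} → α ≈ β → β ≈ γ → α ≈ γ
  ∨-cong  : ∀ {α α' β β'} → α ≈ α' → β ≈ β' → [ α ∨ β ] ≈ [ α' ∨ β' ]
  ∧-cong  : ∀ {α α' β β'} → α ≈ α' → β ≈ β' → ⟨ α ∧ β ⟩ ≈ ⟨ α' ∧ β' ⟩
  ∨-comm  : ∀ {α β} → [ α ∨ β ] ≈ [ β ∨ α ]
  ∧-comm  : ∀ {α β} → ⟨ α ∧ β ⟩ ≈ ⟨ β ∧ α ⟩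
  ∨-assoc : ∀ {α β γ} → [ [ α ∨ β ] ∨ γ ] ≈ [ α ∨ [ β ∨ γ ] ]
  ∧-assoc : ∀ {α β γ} → ⟨ ⟨ α ∧ β ⟩ ∧ γ ⟩ ≈ ⟨ α ∧ ⟨ β ∧ γ ⟩ ⟩
  ∨-unit  : ∀ {α} → [ α ∨ 𝕗 ] ≈ α
  ∧-unit  : ∀ {α} → ⟨ α ∧ 𝕥 ⟩ ≈ α
  𝕥∨𝕥     : [ 𝕥 ∨ 𝕥 ] ≈ 𝕥
  𝕗∧𝕗     : ⟨ 𝕗 ∧ 𝕗 ⟩ ≈ 𝕗

-- Substitutions and renamings
-- A substitution is determined by its values on the positive variables
-- (n , true); the variable (n , false) = bar (n , true) is sent to the dual.

Subst : Set
Subst = ℕ → Formula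

_[_] : Formula → Subst → Formula
𝕗 [ σ ] = 𝕗
𝕥 [ σ ] = 𝕥
atom a [ σ ] = atom a
var (n , true) [ σ ] = σ n
var (n , false) [ σ ] = dual (σ n)
[ α ∨ β ] [ σ ] = [ α [ σ ] ∨ β [ σ ] ]
⟨ α ∧ β ⟩ [ σ ] = ⟨ α [ σ ] ∧ β [ σ ] ⟩

Renaming : Set
Renaming = ℕ → Atom

rename : Renaming → Formula → Formula
rename ρ 𝕗 = 𝕗
rename ρ 𝕥 = 𝕥
rename ρ (atom (n , true)) = atom (ρ n)
rename ρ (atom (n , false)) = atom (bar (ρ n))
rename ρ (var A) = var A
rename ρ [ α ∨ β ] = [ rename ρ α ∨ rename ρ β ]
rename ρ ⟨ α ∧ β ⟩ = ⟨ rename ρ α ∧ rename ρ β ⟩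

data Context : Set where
  □ : Context
  ∨ˡ : Context → Formula → Context
  ∨ʳ : Formula → Context → Context
  ∧ˡ : Context → Formula → Context
  ∧ʳ : Formula → Context → Context

plug : Context → Formula → Formula
plug □ γ = γ
plug (∨ˡ ξ β) γ = [ plug ξ γ ∨ β ]
plug (∨ʳ α ξ) γ = [ α ∨ plug ξ γ ]
plug (∧ˡ ξ β) γ = ⟨ plug ξ γ ∧ β ⟩
plug (∧ʳ α ξ) γ = ⟨ α ∧ plug ξ γ ⟩

Rule : Set
Rule = Formula × Formula

data RuleStep (R : List Rule) : Formula → Formula → Set where
  ruleStep : (r : Rule) → r ∈ R → (ρ : Renaming) (σ : Subst) (ξ : Context) →
             RuleStep R (plug ξ (rename ρ (proj₁ r) [ σ ]))
                        (plug ξ (rename ρ (proj₂ r) [ σ ]))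

vA vB vC : Formula
vA = var (0 , true)
vB = var (1 , true)
vC = var (2 , true)

SKSg : List Rule
SKSg =
    (𝕥 , [ vA ∨ dual vA ])
  ∷ (⟨ vA ∧ dual vA ⟩ , 𝕗)
  ∷ (𝕗 , vA)
  ∷ (vA , 𝕥)
  ∷ ([ vA ∨ vA ] , vA)
  ∷ (vA , ⟨ vA ∧ vA ⟩)
  ∷ (⟨ vA ∧ [ vB ∨ vC ] ⟩ , [ ⟨ vA ∧ vB ⟩ ∨ vC ])
  ∷ []

data SStep : Formula → Formula → Set where
  sksg  : ∀ {γ δ} → RuleStep SKSg γ δ → SStep γ δ
  subst : (γ : Formula) (σ : Subst) → SStep γ (γ [ σ ])

-- Derivations: chains alternating =-steps and (non-=) steps.
-- The index records the kind of the last step, to enforce alternation.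

data Last : Set where
  none eqs other : Last

data Deriv (Step : Formula → Formula → Set) (α : Formula) : Formula → Last → Set where
  start  : Deriv Step α α none
  _▷=_   : ∀ {β l} → Deriv Step α β l → ∀ {γ} → {l ≢ eqs} → β ≈ γ → Deriv Step α γ eqs
  _▷s_   : ∀ {β l} → Deriv Step α β l → ∀ {γ} → {l ≢ other} → Step β γ → Deriv Step α γ other

dlength : ∀ {Step α β l} → Deriv Step α β l → ℕ
dlength start = 0
dlength (d ▷= _) = suc (dlength d)
dlength (d ▷s _) = suc (dlength d)

dsize : ∀ {Step α β l} → Deriv Step α β l → ℕ
dsize {α = α} start = fsize α
dsize (_▷=_ d {γ} _) = dsize d + fsize γ
dsize (_▷s_ d {γ} _) = dsize d + fsize γ

conj : List Formula → Formula
conj [] = 𝕥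
conj (γ ∷ []) = γ
conj (γ ∷ δ ∷ γs) = ⟨ γ ∧ conj (δ ∷ γs) ⟩

extPremiss : (h : ℕ) → (Fin h → Var) → (Fin h → Formula) → Formula
extPremiss h A β =
  conj (concatMap (λ i → [ var (bar (A i)) ∨ β i ] ∷ [ dual (β i) ∨ var (A i) ] ∷ [])
                  (tabulate {n = h} (λ i → i)))

MutuallyDistinct : ∀ {h} → (Fin h → Var) → Set
MutuallyDistinct A = (∀ i j → A i ≡ A j → i ≡ j) × (∀ i j → A i ≢ bar (A j))

record XProof (α : Formula) : Set where
  field
    h       : ℕ
    A       : Fin h → Var
    β       : Fin h → Formula
    distinct : MutuallyDistinct A
    fresh-β : ∀ i j → toℕ j ≤ toℕ i →
              (Occurs (A i) (β j) → ⊥) × (Occurs (bar (A i)) (β j) → ⊥)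
    fresh-α : ∀ i → (Occurs (A i) α → ⊥) × (Occurs (bar (A i)) α → ⊥)
    last    : Last
    deriv   : Deriv (RuleStep SKSg) (extPremiss h A β) α last

xsize : ∀ {α} → XProof α → ℕ
xsize p = dsize (XProof.deriv p)

record SProof (α : Formula) : Set where
  field
    last  : Last
    deriv : Deriv SStep 𝕥 α last

slength ssize : ∀ {α} → SProof α → ℕ
slength p = dlength (SProof.deriv p)
ssize p = dsize (SProof.deriv p)

module Submission where

-- Let P = ([Ā₁ ∨ β₁] ∧ [β̄₁ ∨ A₁] ∧ … ∧ [Āₕ ∨ βₕ] ∧ [β̄ₕ ∨ Aₕ]) be the premiss of an
-- extended proof of α.  The sSKSg proof of α is
--
--   𝕥  ─i↓→  [P ∨ P̄]  ─(the given derivation, in the left disjunct)→  [α ∨ P̄]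
--      =  [α ∨ D₁₁ ∨ D₁₂ ∨ … ∨ Dₕ₁ ∨ Dₕ₂ ∨ 𝕗]  ─(eliminate the pairs, h first)→  α
--
-- where Dᵢ₁, Dᵢ₂ are the duals of the two clauses of the i-th pair.  To eliminate the
-- i-th pair we substitute βᵢ for Aᵢ in the whole line: by the freshness conditions of
-- xSKSg, Aᵢ occurs neither in α nor in the pairs j < i still present, so only Dᵢ₁, Dᵢ₂
-- change, and both become (βᵢ ∧ β̄ᵢ), which i↑ turns into 𝕗.  This costs 3 steps per pair.

open import Defs
open import Function using (_∘_)
open import Data.Nat using (ℕ; zero; suc; _+_; _*_; _≤_; _<_; z≤n; s≤s; _≟_)
open import Data.Nat.Properties
open import Data.Nat.Tactic.RingSolver using (solve-∀)
open import Data.Bool using (Bool; true; false)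
open import Data.Product using (Σ; _×_; ∃; _,_; proj₁; proj₂)
open import Data.Sum using (_⊎_; inj₁; inj₂)
open import Data.Empty using (⊥-elim)
open import Data.Fin using (Fin; zero; suc; toℕ)
open import Data.List using (List; []; _∷_; map; concat; tabulate)
open import Data.List.Properties using (map-tabulate)
open import Data.List.Relation.Unary.Any using (here; there)
open import Relation.Binary.PropositionalEquality
  using (_≡_; _≢_; refl; sym; trans; cong; cong₂; module ≡-Reasoning)
open import Relation.Nullary using (yes; no; ¬_)

bar-involutive : ∀ v → bar (bar v) ≡ v
bar-involutive (n , true) = refl
bar-involutive (n , false) = refl

dual-involutive : ∀ γ → dual (dual γ) ≡ γ
dual-involutive 𝕗 = refl
dual-involutive 𝕥 = refl
dual-involutive (atom a) = cong atom (bar-involutive a)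
dual-involutive (var v) = cong var (bar-involutive v)
dual-involutive [ γ ∨ δ ] = cong₂ [_∨_] (dual-involutive γ) (dual-involutive δ)
dual-involutive ⟨ γ ∧ δ ⟩ = cong₂ ⟨_∧_⟩ (dual-involutive γ) (dual-involutive δ)

fsize-dual : ∀ γ → fsize (dual γ) ≡ fsize γ
fsize-dual 𝕗 = refl
fsize-dual 𝕥 = refl
fsize-dual (atom a) = refl
fsize-dual (var v) = refl
fsize-dual [ γ ∨ δ ] = cong₂ _+_ (fsize-dual γ) (fsize-dual δ)
fsize-dual ⟨ γ ∧ δ ⟩ = cong₂ _+_ (fsize-dual γ) (fsize-dual δ)

fsize-positive : ∀ γ → 1 ≤ fsize γ
fsize-positive 𝕗 = s≤s z≤n
fsize-positive 𝕥 = s≤s z≤n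
fsize-positive (atom a) = s≤s z≤n
fsize-positive (var v) = s≤s z≤n
fsize-positive [ γ ∨ δ ] = ≤-trans (fsize-positive γ) (m≤m+n _ _)
fsize-positive ⟨ γ ∧ δ ⟩ = ≤-trans (fsize-positive γ) (m≤m+n _ _)

≡⇒≈ : ∀ {γ δ} → γ ≡ δ → γ ≈ δ
≡⇒≈ refl = ≈-refl

-- A variable is a name with a polarity; v and v̄ share their name.  Freshness of a name
-- (neither polarity occurs) is the notion preserved by duals and substitutions.

name : Var → ℕ
name = proj₁

Fresh : ℕ → Formula → Set
Fresh n γ = ∀ {v} → Occurs v γ → name v ≢ n

same-name : ∀ {v w : Var} → name v ≡ name w → v ≡ w ⊎ v ≡ bar w
same-name {m , true} {_ , true} refl = inj₁ refl
same-name {m , true} {_ , false} refl = inj₂ refl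
same-name {m , false} {_ , true} refl = inj₂ refl
same-name {m , false} {_ , false} refl = inj₁ refl

fresh-name : ∀ {a γ} → ¬ Occurs a γ → ¬ Occurs (bar a) γ → Fresh (name a) γ
fresh-name {a} a∉γ ā∉γ {v} o eq with same-name {v} {a} eq
... | inj₁ refl = a∉γ o
... | inj₂ refl = ā∉γ o

distinct-names : ∀ {h} {A : Fin h → Var} → MutuallyDistinct A →
                 ∀ {i j} → name (A i) ≡ name (A j) → i ≡ j
distinct-names {A = A} (injective , not-dual) {i} {j} eq with same-name {A i} {A j} eq
... | inj₁ Ai≡Aj = injective i j Ai≡Aj
... | inj₂ Ai≡Āj = ⊥-elim (not-dual i j Ai≡Āj)

occurs-dual : ∀ {v} γ → Occurs v (dual γ) → Occurs (bar v) γ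
occurs-dual 𝕗 ()
occurs-dual 𝕥 ()
occurs-dual (atom a) ()
occurs-dual (var w) refl = bar-involutive w
occurs-dual [ γ ∨ δ ] (inj₁ o) = inj₁ (occurs-dual γ o)
occurs-dual [ γ ∨ δ ] (inj₂ o) = inj₂ (occurs-dual δ o)
occurs-dual ⟨ γ ∧ δ ⟩ (inj₁ o) = inj₁ (occurs-dual γ o)
occurs-dual ⟨ γ ∧ δ ⟩ (inj₂ o) = inj₂ (occurs-dual δ o)

fresh-dual : ∀ {n} γ → Fresh n γ → Fresh n (dual γ)
fresh-dual γ fresh o = fresh (occurs-dual γ o)

fresh-∨ : ∀ {n} γ δ → Fresh n γ → Fresh n δ → Fresh n [ γ ∨ δ ]
fresh-∨ γ δ fγ fδ (inj₁ o) = fγ o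
fresh-∨ γ δ fγ fδ (inj₂ o) = fδ o

-- assign a b is the substitution a ↦ b (hence ā ↦ b̄) that fixes every other name.

polarise : Bool → Formula → Formula
polarise true b = b
polarise false b = dual b

assign : Var → Formula → Subst
assign (n , s) b m with m ≟ n
... | yes _ = polarise s b
... | no _ = var (m , true)

subst-fresh : ∀ {a} b γ → Fresh (name a) γ → γ [ assign a b ] ≡ γ
subst-fresh b 𝕗 fresh = refl
subst-fresh b 𝕥 fresh = refl
subst-fresh b (atom x) fresh = refl
subst-fresh {n , s} b (var (m , true)) fresh with m ≟ n
... | yes m≡n = ⊥-elim (fresh refl m≡n)
... | no _ = refl
subst-fresh {n , s} b (var (m , false)) fresh with m ≟ n
... | yes m≡n = ⊥-elim (fresh refl m≡n)
... | no _ = refl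
subst-fresh b [ γ ∨ δ ] fresh =
  cong₂ [_∨_] (subst-fresh b γ (fresh ∘ inj₁)) (subst-fresh b δ (fresh ∘ inj₂))
subst-fresh b ⟨ γ ∧ δ ⟩ fresh =
  cong₂ ⟨_∧_⟩ (subst-fresh b γ (fresh ∘ inj₁)) (subst-fresh b δ (fresh ∘ inj₂))

assign-var : ∀ a b → var a [ assign a b ] ≡ b
assign-var (n , true) b rewrite ≟-diag (refl {x = n}) = refl
assign-var (n , false) b rewrite ≟-diag (refl {x = n}) = dual-involutive b

assign-bar : ∀ a b → var (bar a) [ assign a b ] ≡ dual b
assign-bar (n , true) b rewrite ≟-diag (refl {x = n}) = refl
assign-bar (n , false) b rewrite ≟-diag (refl {x = n}) = refl

subst-dual : ∀ σ γ → dual γ [ σ ] ≡ dual (γ [ σ ])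
subst-dual σ 𝕗 = refl
subst-dual σ 𝕥 = refl
subst-dual σ (atom a) = refl
subst-dual σ (var (n , true)) = refl
subst-dual σ (var (n , false)) = sym (dual-involutive (σ n))
subst-dual σ [ γ ∨ δ ] = cong₂ ⟨_∧_⟩ (subst-dual σ γ) (subst-dual σ δ)
subst-dual σ ⟨ γ ∧ δ ⟩ = cong₂ [_∨_] (subst-dual σ γ) (subst-dual σ δ)

premiss≤size : ∀ {S α β l} (d : Deriv S α β l) → fsize α ≤ dsize d
premiss≤size start = ≤-refl
premiss≤size (d ▷= _) = ≤-trans (premiss≤size d) (m≤m+n _ _)
premiss≤size (d ▷s _) = ≤-trans (premiss≤size d) (m≤m+n _ _)

conclusion≤size : ∀ {S α β l} (d : Deriv S α β l) → fsize β ≤ dsize d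
conclusion≤size start = ≤-refl
conclusion≤size (d ▷= _) = m≤n+m _ _
conclusion≤size (d ▷s _) = m≤n+m _ _

length<size : ∀ {S α β l} (d : Deriv S α β l) → dlength d < dsize d
length<size {α = α} start = fsize-positive α
length<size (_▷=_ d {γ} _) = ≤-trans (≤-reflexive (+-comm 1 _)) (+-mono-≤ (length<size d) (fsize-positive γ))
length<size (_▷s_ d {γ} _) = ≤-trans (≤-reflexive (+-comm 1 _)) (+-mono-≤ (length<size d) (fsize-positive γ))

size-positive : ∀ {S α β l} (d : Deriv S α β l) → 1 ≤ dsize d
size-positive d = ≤-trans (s≤s z≤n) (length<size d)

-- A chain is a derivation in normal form: it alternates =-steps and Step-steps, and starts
-- and ends with an =-step.  Chains concatenate freely (adjacent =-steps merge), and a chain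
-- with k steps whose lines have size ≤ M extends any derivation by 2k + 1 steps and at most
-- (2k + 1) M symbols.

module Chains (Step : Formula → Formula → Set) where

  data Chain : Formula → Formula → Set where
    done : ∀ {α β} → α ≈ β → Chain α β
    step : ∀ {α β γ δ} → α ≈ β → Step β γ → Chain γ δ → Chain α δ

  steps : ∀ {α β} → Chain α β → ℕ
  steps (done _) = 0
  steps (step _ _ c) = suc (steps c)

  Within : ∀ {α β} → ℕ → Chain α β → Set
  Within M (done {β = β} _) = fsize β ≤ M
  Within M (step {β = β} {γ = γ} _ _ c) = fsize β ≤ M × fsize γ ≤ M × Within M c

  within-mono : ∀ {α β M N} (c : Chain α β) → M ≤ N → Within M c → Within N c
  within-mono (done _) M≤N b = ≤-trans b M≤N
  within-mono (step _ _ c) M≤N (b₁ , b₂ , b) = ≤-trans b₁ M≤N , ≤-trans b₂ M≤N , within-mono c M≤N b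

  pre : ∀ {α β γ} → α ≈ β → Chain β γ → Chain α γ
  pre e (done e′) = done (≈-trans e e′)
  pre e (step e′ s c) = step (≈-trans e e′) s c

  steps-pre : ∀ {α β γ} (e : α ≈ β) (c : Chain β γ) → steps (pre e c) ≡ steps c
  steps-pre e (done _) = refl
  steps-pre e (step _ _ _) = refl

  within-pre : ∀ {α β γ M} (e : α ≈ β) (c : Chain β γ) → Within M c → Within M (pre e c)
  within-pre e (done _) b = b
  within-pre e (step _ _ _) b = b

  infixr 5 _++ᶜ_
  _++ᶜ_ : ∀ {α β γ} → Chain α β → Chain β γ → Chain α γ
  done e ++ᶜ c′ = pre e c′
  step e s c ++ᶜ c′ = step e s (c ++ᶜ c′)

  steps-++ : ∀ {α β γ} (c : Chain α β) (c′ : Chain β γ) → steps (c ++ᶜ c′) ≡ steps c + steps c′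
  steps-++ (done e) c′ = steps-pre e c′
  steps-++ (step _ _ c) c′ = cong suc (steps-++ c c′)

  within-++ : ∀ {α β γ M} (c : Chain α β) (c′ : Chain β γ) → Within M c → Within M c′ → Within M (c ++ᶜ c′)
  within-++ (done e) c′ _ b′ = within-pre e c′ b′
  within-++ (step _ _ c) c′ (b₁ , b₂ , b) b′ = b₁ , b₂ , within-++ c c′ b b′

  extend : ∀ {α β γ l} → Deriv Step α β l → l ≢ eqs → Chain β γ → Deriv Step α γ eqs
  extend d ok (done e) = _▷=_ d {_} {ok} e
  extend d ok (step e s c) = extend (_▷s_ (_▷=_ d {_} {ok} e) {_} {λ ()} s) (λ ()) c

  length-extend : ∀ {α β γ l} (d : Deriv Step α β l) ok (c : Chain β γ) →
                  dlength (extend d ok c) ≡ dlength d + suc (2 * steps c)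
  length-extend d ok (done e) = sym (+-comm (dlength d) 1)
  length-extend d ok (step e s c) = trans (length-extend _ (λ ()) c) (shift (dlength d) (steps c))
    where
      shift : ∀ x k → suc (suc x) + suc (2 * k) ≡ x + suc (2 * suc k)
      shift = solve-∀

  size-extend : ∀ {α β γ l M} (d : Deriv Step α β l) ok (c : Chain β γ) → Within M c →
                dsize (extend d ok c) ≤ dsize d + suc (2 * steps c) * M
  size-extend {M = M} d ok (done e) b = +-monoʳ-≤ (dsize d) (≤-trans b (m≤m+n M 0))
  size-extend {M = M} d ok (step {β = β} {γ = γ} e s c) (b₁ , b₂ , b) = begin
    dsize (extend _ _ c)                              ≤⟨ size-extend _ (λ ()) c b ⟩
    dsize d + fsize β + fsize γ + suc (2 * steps c) * M ≤⟨ +-monoˡ-≤ _ (+-mono-≤ (+-monoʳ-≤ (dsize d) b₁) b₂) ⟩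
    dsize d + M + M + suc (2 * steps c) * M         ≡⟨ regroup (dsize d) M (steps c) ⟩
    dsize d + suc (2 * suc (steps c)) * M           ∎
    where
      open ≤-Reasoning
      regroup : ∀ x m k → x + m + m + suc (2 * k) * m ≡ x + suc (2 * suc k) * m
      regroup = solve-∀

open Chains SStep

realise : ∀ {α} → Chain 𝕥 α → SProof α
realise c = record { last = eqs ; deriv = extend start (λ ()) c }

length-realise : ∀ {α} (c : Chain 𝕥 α) → slength (realise c) ≡ suc (2 * steps c)
length-realise c = length-extend start (λ ()) c

size-realise : ∀ {α M} (c : Chain 𝕥 α) → Within M c → ssize (realise c) ≤ 1 + suc (2 * steps c) * M
size-realise c = size-extend start (λ ()) c

inLeft : ∀ {R γ δ} Q → RuleStep R γ δ → RuleStep R [ γ ∨ Q ] [ δ ∨ Q ]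
inLeft Q (ruleStep r r∈R ρ σ ξ) = ruleStep r r∈R ρ σ (∨ˡ ξ Q)

embed : ∀ {P γ δ l} Q → Deriv (RuleStep SKSg) P γ l → Chain [ γ ∨ Q ] δ → Chain [ P ∨ Q ] δ
embed Q start c = c
embed Q (d ▷= e) c = embed Q d (pre (∨-cong e ≈-refl) c)
embed Q (d ▷s s) c = embed Q d (step ≈-refl (sksg (inLeft Q s)) c)

steps-embed : ∀ {P γ δ l} Q (d : Deriv (RuleStep SKSg) P γ l) (c : Chain [ γ ∨ Q ] δ) →
              steps (embed Q d c) ≤ dlength d + steps c
steps-embed Q start c = ≤-refl
steps-embed Q (d ▷= e) c =
  ≤-trans (steps-embed Q d _) (≤-trans (≤-reflexive (cong (dlength d +_) (steps-pre _ c))) (n≤1+n _))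
steps-embed Q (d ▷s s) c =
  ≤-trans (steps-embed Q d _) (≤-reflexive (+-suc (dlength d) (steps c)))

within-embed : ∀ {P γ δ l M} Q (d : Deriv (RuleStep SKSg) P γ l) (c : Chain [ γ ∨ Q ] δ) →
               dsize d + fsize Q ≤ M → Within M c → Within M (embed Q d c)
within-embed Q start c _ b = b
within-embed Q (d ▷= e) c bound b =
  within-embed Q d _ (≤-trans (+-monoˡ-≤ (fsize Q) (m≤m+n _ _)) bound) (within-pre _ c b)
within-embed {M = M} Q (_▷s_ d {γ} s) c bound b =
  within-embed Q d _ bound′ (≤-trans (+-monoˡ-≤ (fsize Q) (conclusion≤size d)) bound′ ,
                             ≤-trans (+-monoˡ-≤ (fsize Q) (m≤n+m (fsize γ) (dsize d))) bound , b)
  where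
    bound′ : dsize d + fsize Q ≤ M
    bound′ = ≤-trans (+-monoˡ-≤ (fsize Q) (m≤m+n (dsize d) (fsize γ))) bound

interaction↓ : ∀ P → SStep 𝕥 [ P ∨ dual P ]
interaction↓ P = sksg (ruleStep _ (here refl) (λ _ → (0 , true)) (λ _ → P) □)

interaction↑ : ∀ ξ b → SStep (plug ξ ⟨ b ∧ dual b ⟩) (plug ξ 𝕗)
interaction↑ ξ b = sksg (ruleStep _ (there (here refl)) (λ _ → (0 , true)) (λ _ → b) ξ)

clause₁ clause₂ : Var → Formula → Formula
clause₁ a b = [ var (bar a) ∨ b ]
clause₂ a b = [ dual b ∨ var a ]

clauses : Var → Formula → List Formula
clauses a b = clause₁ a b ∷ clause₂ a b ∷ []

extClauses : (h : ℕ) → (Fin h → Var) → (Fin h → Formula) → List Formula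
extClauses h A β = concat (tabulate (λ i → clauses (A i) (β i)))

premiss-clauses : ∀ h A β → extPremiss h A β ≡ conj (extClauses h A β)
premiss-clauses h A β = cong (conj ∘ concat) (map-tabulate (λ i → i) (λ i → clauses (A i) (β i)))

disj : List Formula → Formula
disj [] = 𝕗
disj (γ ∷ γs) = [ γ ∨ disj γs ]

dual-conj : ∀ γs → dual (conj γs) ≈ disj (map dual γs)
dual-conj [] = ≈-refl
dual-conj (γ ∷ []) = ≈-sym ∨-unit
dual-conj (γ ∷ δ ∷ γs) = ∨-cong ≈-refl (dual-conj (δ ∷ γs))

fsize-disj-dual : ∀ γs → fsize (disj (map dual γs)) ≤ suc (fsize (conj γs))
fsize-disj-dual [] = s≤s z≤n
fsize-disj-dual (γ ∷ []) = ≤-reflexive (trans (cong (_+ 1) (fsize-dual γ)) (+-comm (fsize γ) 1))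
fsize-disj-dual (γ ∷ δ ∷ γs) =
  ≤-trans (+-mono-≤ (≤-reflexive (fsize-dual γ)) (fsize-disj-dual (δ ∷ γs))) (≤-reflexive (+-suc (fsize γ) _))

extDisj : (h : ℕ) → (Fin h → Var) → (Fin h → Formula) → Formula
extDisj h A β = disj (map dual (extClauses h A β))

-- it has at least one symbol per pair (plus the final 𝕗)
pairs<fsize : ∀ h A β → h < fsize (extDisj h A β)
pairs<fsize zero A β = s≤s z≤n
pairs<fsize (suc h) A β = begin-strict
  suc h              <⟨ s≤s (pairs<fsize h (A ∘ suc) (β ∘ suc)) ⟩
  1 + fsize T        ≤⟨ +-monoˡ-≤ (fsize T) (fsize-positive D₂) ⟩
  fsize D₂ + fsize T ≤⟨ m≤n+m (fsize D₂ + fsize T) (fsize D₁) ⟩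
  fsize (extDisj (suc h) A β) ∎
  where
    open ≤-Reasoning
    D₁ D₂ T : Formula
    D₁ = dual (clause₁ (A zero) (β zero))
    D₂ = dual (clause₂ (A zero) (β zero))
    T = extDisj h (A ∘ suc) (β ∘ suc)

clause₁-instance : ∀ a b → Fresh (name a) b → clause₁ a b [ assign a b ] ≡ [ dual b ∨ b ]
clause₁-instance a b fresh = cong₂ [_∨_] (assign-bar a b) (subst-fresh b b fresh)

clause₂-instance : ∀ a b → Fresh (name a) b → clause₂ a b [ assign a b ] ≡ [ dual b ∨ b ]
clause₂-instance a b fresh = cong₂ [_∨_] (subst-fresh b (dual b) (fresh-dual b fresh)) (assign-var a b)

refuted : ∀ σ γ b → γ [ σ ] ≡ [ dual b ∨ b ] → dual γ [ σ ] ≡ ⟨ b ∧ dual b ⟩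
refuted σ γ b eq = begin
  dual γ [ σ ]                 ≡⟨ subst-dual σ γ ⟩
  dual (γ [ σ ])               ≡⟨ cong dual eq ⟩
  ⟨ dual (dual b) ∧ dual b ⟩   ≡⟨ cong (⟨_∧ dual b ⟩) (dual-involutive b) ⟩
  ⟨ b ∧ dual b ⟩               ∎
  where open ≡-Reasoning

CostedChain : Formula → Formula → ℕ → ℕ → Set
CostedChain γ δ k M = Σ (Chain γ δ) λ c → steps c ≡ k × Within M c

-- Each line of the pair elimination is [[R ∨ x] ∨ y] with |x|, |y| ≤ |D₁| + |D₂|, or R.
pair-line : ∀ R x y K → fsize x ≤ K → fsize y ≤ K → fsize [ [ R ∨ x ] ∨ y ] ≤ fsize R + 2 * K
pair-line R x y K x≤K y≤K =
  ≤-trans (≤-reflexive (+-assoc (fsize R) (fsize x) (fsize y)))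
          (+-monoʳ-≤ (fsize R) (+-mono-≤ x≤K (≤-trans y≤K (m≤m+n K 0))))

eliminate-pair : ∀ R a b → Fresh (name a) R → Fresh (name a) b →
  let D₁ = dual (clause₁ a b) ; D₂ = dual (clause₂ a b) in
  CostedChain [ [ R ∨ D₁ ] ∨ D₂ ] R 3 (fsize R + 2 * (fsize D₁ + fsize D₂))
eliminate-pair R a b fresh-R fresh-b =
  step ≈-refl (subst line σ)
    (step (≡⇒≈ substituted) (interaction↑ (∨ˡ (∨ʳ R □) contra) b)
      (step ≈-refl (interaction↑ (∨ʳ [ R ∨ 𝕗 ] □) b)
        (done (≈-trans ∨-unit ∨-unit)))) ,
  refl ,
  line-bound D₁ D₂ D₁≤ D₂≤ ,
  ≤-trans (≤-reflexive (cong fsize substituted)) (line-bound contra contra contra≤ contra≤) ,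
  (line-bound contra contra contra≤ contra≤ , line-bound 𝕗 contra 𝕗≤ contra≤ ,
   (line-bound 𝕗 contra 𝕗≤ contra≤ , line-bound 𝕗 𝕗 𝕗≤ 𝕗≤ , m≤m+n _ _))
  where
    σ : Subst
    σ = assign a b
    D₁ D₂ line contra : Formula
    D₁ = dual (clause₁ a b)
    D₂ = dual (clause₂ a b)
    line = [ [ R ∨ D₁ ] ∨ D₂ ]
    contra = ⟨ b ∧ dual b ⟩
    K : ℕ
    K = fsize D₁ + fsize D₂

    substituted : line [ σ ] ≡ [ [ R ∨ contra ] ∨ contra ]
    substituted =
      cong₂ [_∨_] (cong₂ [_∨_] (subst-fresh b R fresh-R)
                               (refuted σ (clause₁ a b) b (clause₁-instance a b fresh-b)))
                  (refuted σ (clause₂ a b) b (clause₂-instance a b fresh-b))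

    line-bound : ∀ x y → fsize x ≤ K → fsize y ≤ K → fsize [ [ R ∨ x ] ∨ y ] ≤ fsize R + 2 * K
    line-bound x y = pair-line R x y K

    D₁≤ : fsize D₁ ≤ K
    D₁≤ = m≤m+n (fsize D₁) (fsize D₂)
    D₂≤ : fsize D₂ ≤ K
    D₂≤ = m≤n+m (fsize D₂) (fsize D₁)
    𝕗≤ : fsize 𝕗 ≤ K
    𝕗≤ = ≤-trans (fsize-positive D₁) D₁≤
    contra≤ : fsize contra ≤ K
    contra≤ = +-mono-≤ (≤-trans (n≤1+n (fsize b)) (≤-reflexive (sym (fsize-dual (clause₁ a b)))))
                       (≤-trans (m≤m+n (fsize (dual b)) 1) (≤-reflexive (sym (fsize-dual (clause₂ a b)))))

fresh-pair : ∀ {n} a b → name a ≢ n → Fresh n b → Fresh n ⟨ clause₁ a b ∧ clause₂ a b ⟩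
fresh-pair a b apart fresh (inj₁ (inj₁ refl)) = apart
fresh-pair a b apart fresh (inj₁ (inj₂ o)) = fresh o
fresh-pair a b apart fresh (inj₂ (inj₁ o)) = fresh-dual b fresh o
fresh-pair a b apart fresh (inj₂ (inj₂ refl)) = apart

-- All pairs, the last one first.  The hypotheses are what xSKSg guarantees: Aᵢ is fresh
-- for the rest R of the line, for βᵢ, and for the pairs j < i that are still present.
eliminate : ∀ R h (A : Fin h → Var) (β : Fin h → Formula) →
  (∀ i → Fresh (name (A i)) R) →
  (∀ i → Fresh (name (A i)) (β i)) →
  (∀ i j → toℕ j < toℕ i → Fresh (name (A i)) ⟨ clause₁ (A j) (β j) ∧ clause₂ (A j) (β j) ⟩) →
  CostedChain [ R ∨ extDisj h A β ] R (3 * h) (fsize R + 2 * fsize (extDisj h A β))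
eliminate R zero A β _ _ _ = done ∨-unit , refl , m≤m+n _ _
eliminate R (suc h) A β fresh-R fresh-β fresh-pair =
  pre reassociate others ++ᶜ first ,
  count ,
  within-++ (pre reassociate others) first
    (within-pre reassociate others
      (within-mono others (regroup (fsize R) (fsize D₁) (fsize D₂) (fsize T)) (proj₂ (proj₂ later-pairs))))
    (within-mono first (+-monoʳ-≤ (fsize R) (*-monoʳ-≤ 2 (+-monoʳ-≤ (fsize D₁) (m≤m+n (fsize D₂) (fsize T)))))
      (proj₂ (proj₂ first-pair)))
  where
    D₁ D₂ R′ T : Formula
    D₁ = dual (clause₁ (A zero) (β zero))
    D₂ = dual (clause₂ (A zero) (β zero))
    R′ = [ [ R ∨ D₁ ] ∨ D₂ ]
    T = extDisj h (A ∘ suc) (β ∘ suc)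

    reassociate : [ R ∨ [ D₁ ∨ [ D₂ ∨ T ] ] ] ≈ [ R′ ∨ T ]
    reassociate = ≈-trans (≈-sym ∨-assoc) (≈-sym ∨-assoc)

    fresh-R′ : ∀ i → Fresh (name (A (suc i))) R′
    fresh-R′ i = fresh-∨ [ R ∨ D₁ ] D₂
                   (fresh-∨ R D₁ (fresh-R (suc i)) (fresh-dual (clause₁ (A zero) (β zero)) (λ o → earlier (inj₁ o))))
                   (fresh-dual (clause₂ (A zero) (β zero)) (λ o → earlier (inj₂ o)))
      where
        earlier : Fresh (name (A (suc i))) ⟨ clause₁ (A zero) (β zero) ∧ clause₂ (A zero) (β zero) ⟩
        earlier = fresh-pair (suc i) zero (s≤s z≤n)

    later-pairs : CostedChain [ R′ ∨ T ] R′ (3 * h) (fsize R′ + 2 * fsize T)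
    later-pairs = eliminate R′ h (A ∘ suc) (β ∘ suc) fresh-R′ (fresh-β ∘ suc)
                            (λ i j j<i → fresh-pair (suc i) (suc j) (s≤s j<i))
    others : Chain [ R′ ∨ T ] R′
    others = proj₁ later-pairs
    first-pair : CostedChain R′ R 3 (fsize R + 2 * (fsize D₁ + fsize D₂))
    first-pair = eliminate-pair R (A zero) (β zero) (fresh-R zero) (fresh-β zero)
    first : Chain R′ R
    first = proj₁ first-pair

    count : steps (pre reassociate others ++ᶜ first) ≡ 3 * suc h
    count = begin
      steps (pre reassociate others ++ᶜ first)      ≡⟨ steps-++ (pre reassociate others) first ⟩
      steps (pre reassociate others) + steps first  ≡⟨ cong₂ _+_ (trans (steps-pre reassociate others)
                                                                        (proj₁ (proj₂ later-pairs)))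
                                                                 (proj₁ (proj₂ first-pair)) ⟩
      3 * h + 3                                 ≡⟨ +-comm (3 * h) 3 ⟩
      3 + 3 * h                                 ≡⟨ sym (*-suc 3 h) ⟩
      3 * suc h                                 ∎
      where open ≡-Reasoning

    regroup : ∀ r d₁ d₂ t → r + d₁ + d₂ + 2 * t ≤ r + 2 * (d₁ + (d₂ + t))
    regroup r d₁ d₂ t = ≤-trans (m≤m+n _ (d₁ + d₂)) (≤-reflexive (expand r d₁ d₂ t))
      where
        expand : ∀ r d₁ d₂ t → r + d₁ + d₂ + 2 * t + (d₁ + d₂) ≡ r + 2 * (d₁ + (d₂ + t))
        expand = solve-∀

translate : ∀ {α} (p : XProof α) → let n = xsize p in
            Σ (Chain 𝕥 α) λ c → steps c ≤ 4 * n × Within (n + 2 * suc n) c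
translate {α} p = chain , step-count , chain-within
  where
    open XProof p
    P : Formula
    P = extPremiss h A β
    n M : ℕ
    n = dsize deriv
    M = n + 2 * suc n

    P≤n : fsize P ≤ n
    P≤n = premiss≤size deriv
    n≤2[1+n] : n ≤ 2 * suc n
    n≤2[1+n] = ≤-trans (n≤1+n n) (m≤m+n (suc n) (suc n + 0))
    P̄≤2[1+n] : fsize (dual P) ≤ 2 * suc n
    P̄≤2[1+n] = ≤-trans (≤-reflexive (fsize-dual P)) (≤-trans P≤n n≤2[1+n])
    α≤n : fsize α ≤ n
    α≤n = conclusion≤size deriv

    dual-premiss : dual P ≈ extDisj h A β
    dual-premiss = ≈-trans (≡⇒≈ (cong dual (premiss-clauses h A β))) (dual-conj (extClauses h A β))
    disj≤ : fsize (extDisj h A β) ≤ suc n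
    disj≤ = ≤-trans (fsize-disj-dual (extClauses h A β))
                    (s≤s (≤-trans (≤-reflexive (cong fsize (sym (premiss-clauses h A β)))) P≤n))
    h≤n : h ≤ n
    h≤n = ≤-pred (≤-trans (pairs<fsize h A β) disj≤)

    eliminated : CostedChain [ α ∨ extDisj h A β ] α (3 * h) (fsize α + 2 * fsize (extDisj h A β))
    eliminated = eliminate α h A β
      (λ i → fresh-name (proj₁ (fresh-α i)) (proj₂ (fresh-α i)))
      (λ i → fresh-name (proj₁ (fresh-β i i ≤-refl)) (proj₂ (fresh-β i i ≤-refl)))
      (λ i j j<i → fresh-pair (A j) (β j)
         (λ same → <-irrefl (cong toℕ (distinct-names distinct same)) j<i)
         (fresh-name (proj₁ (fresh-β i j (<⇒≤ j<i))) (proj₂ (fresh-β i j (<⇒≤ j<i)))))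

    elimination : Chain [ α ∨ dual P ] α
    elimination = pre (∨-cong ≈-refl dual-premiss) (proj₁ eliminated)

    chain : Chain 𝕥 α
    chain = step ≈-refl (interaction↓ P) (embed (dual P) deriv elimination)

    chain-within : Within M chain
    chain-within =
      ≤-trans (s≤s z≤n) (m≤n+m (2 * suc n) n) ,
      +-mono-≤ P≤n P̄≤2[1+n] ,
      within-embed (dual P) deriv elimination (+-monoʳ-≤ n P̄≤2[1+n])
        (within-pre (∨-cong ≈-refl dual-premiss) (proj₁ eliminated)
          (within-mono (proj₁ eliminated) (+-mono-≤ α≤n (*-monoʳ-≤ 2 disj≤)) (proj₂ (proj₂ eliminated))))

    step-count : steps chain ≤ 4 * n
    step-count = begin
      steps chain                                   ≤⟨ s≤s (steps-embed (dual P) deriv elimination) ⟩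
      suc (dlength deriv + steps elimination)       ≡⟨ cong (λ k → suc (dlength deriv + k))
                                                          (trans (steps-pre _ (proj₁ eliminated)) (proj₁ (proj₂ eliminated))) ⟩
      suc (dlength deriv) + 3 * h                   ≤⟨ +-mono-≤ (length<size deriv) (*-monoʳ-≤ 3 h≤n) ⟩
      n + 3 * n                                     ≡⟨ collect n ⟩
      4 * n                                          ∎
      where
        open ≤-Reasoning
        collect : ∀ n → n + 3 * n ≡ 4 * n
        collect = solve-∀

-- The final count: length ≤ 9n ≤ 46n and size ≤ 1 + 9n(3n + 2) ≤ 46n².
final-bounds : ∀ {n k S} → 1 ≤ n → k ≤ 4 * n → S ≤ 1 + suc (2 * k) * (n + 2 * suc n) →
               suc (2 * k) ≤ 46 * n × S ≤ 46 * (n * n)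
final-bounds {n} {k} {S} 1≤n k≤4n S≤ = ≤-trans L≤9n (*-monoˡ-≤ n (m≤m+n 9 37)) , size
  where
    open ≤-Reasoning
    collect₁ : ∀ n → n + 2 * (4 * n) ≡ 9 * n
    collect₁ = solve-∀
    expand : ∀ n → 1 + 9 * n * (n + 2 * suc n) ≡ 1 + 18 * n + 27 * (n * n)
    expand = solve-∀
    collect₂ : ∀ n → n * n + 18 * (n * n) + 27 * (n * n) ≡ 46 * (n * n)
    collect₂ = solve-∀
    L≤9n : suc (2 * k) ≤ 9 * n
    L≤9n = begin
      1 + 2 * k         ≤⟨ +-mono-≤ 1≤n (*-monoʳ-≤ 2 k≤4n) ⟩
      n + 2 * (4 * n)   ≡⟨ collect₁ n ⟩
      9 * n             ∎
    n≤n*n : n ≤ n * n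
    n≤n*n = ≤-trans (≤-reflexive (sym (*-identityʳ n))) (*-monoʳ-≤ n 1≤n)
    size : S ≤ 46 * (n * n)
    size = begin
      S                                       ≤⟨ S≤ ⟩
      1 + suc (2 * k) * (n + 2 * suc n)       ≤⟨ +-monoʳ-≤ 1 (*-monoˡ-≤ (n + 2 * suc n) L≤9n) ⟩
      1 + 9 * n * (n + 2 * suc n)             ≡⟨ expand n ⟩
      1 + 18 * n + 27 * (n * n)               ≤⟨ +-monoˡ-≤ (27 * (n * n)) (+-mono-≤ (*-mono-≤ 1≤n 1≤n) (*-monoʳ-≤ 18 n≤n*n)) ⟩
      n * n + 18 * (n * n) + 27 * (n * n)     ≡⟨ collect₂ n ⟩
      46 * (n * n)                            ∎

theorem5p11 : ∃ λ (c : ℕ) → ∀ (α : Formula) (p : XProof α) →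
    Σ (SProof α) λ q → (slength q ≤ c * xsize p) × (ssize q ≤ c * (xsize p * xsize p))
theorem5p11 = 46 , λ α p →
  let (c , steps≤4n , within) = translate p
      (length≤ , size≤) = final-bounds (size-positive (XProof.deriv p)) steps≤4n (size-realise c within)
  in realise c , ≤-trans (≤-reflexive (length-realise c)) length≤ , size≤
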